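{- Let $k\ge1$ and let $T$ be a rooted tree with $n$ distinguishable nodes. The number $|\mathcal{L}^{[k]}(T)|$ of increasing $k$-labellings of $T$ with label set $\{1,\dots,kn\}$ is \[|\mathcal{L}^{[k]}(T)|=\frac{(kn)!}{\prod_{v\in T}(k h_v)^{\underline{k}}}.\]
   Context: An increasing $k$-labelling of a tree $T$ with $n$ nodes assigns to each node $v$ a set of exactly $k$ integers from $\{1,\dots,kn\}$, the sets of distinct nodes being disjoint, such that whenever $w$ is a child of $v$, every label of $w$ is larger than every label of $v$. The hook-length $h_v$ is the number of descendants of $v$ including $v$ itself. $x^{\underline{s}}=x(x-1)\cdots(x-s+1)$ denotes the falling factorial. -}

module Defs where

open import Data.Nat using (ℕ; zero; suc; _+_; _*_; _∸_; _<_)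
open import Data.List using (List; []; _∷_; _++_)
open import Data.List.Relation.Unary.All using (All)
open import Data.List.Relation.Unary.AllPairs using (AllPairs)
open import Data.Fin using (Fin; toℕ)
open import Data.Fin.Subset using (Subset; _∈_; _∩_; ⊥; ∣_∣)
open import Relation.Binary.PropositionalEquality using (_≡_)
open import Data.Product using (_×_)

-- Rooted trees: a node with a (finite) list of children.
-- Nodes are distinguished by their position in the tree.
data Tree : Set where
  node : List Tree → Tree

mutual
  size : Tree → ℕ
  size (node ts) = suc (sizes ts)

  sizes : List Tree → ℕ
  sizes []       = 0
  sizes (t ∷ ts) = size t + sizes ts

_↓_ : ℕ → ℕ → ℕ
x ↓ zero  = 1
x ↓ suc s = x * ((x ∸ 1) ↓ s)

-- ∏_{v ∈ T} (k h_v)^{\underline k}, where h_v = size of the subtree rooted at v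
mutual
  hookProd : ℕ → Tree → ℕ
  hookProd k t@(node ts) = ((k * size t) ↓ k) * hookProds k ts

  hookProds : ℕ → List Tree → ℕ
  hookProds k []       = 1
  hookProds k (t ∷ ts) = hookProd k t * hookProds k ts

data LTree (A : Set) : Set where
  lnode : A → List (LTree A) → LTree A

module _ {A : Set} where
  mutual
    shape : LTree A → Tree
    shape (lnode _ cs) = node (shapes cs)

    shapes : List (LTree A) → List Tree
    shapes []       = []
    shapes (c ∷ cs) = shape c ∷ shapes cs

  mutual
    labels : LTree A → List A
    labels (lnode a cs) = a ∷ labelsL cs

    labelsL : List (LTree A) → List A
    labelsL []       = []
    labelsL (c ∷ cs) = labels c ++ labelsL cs

  rootLabel : LTree A → A
  rootLabel (lnode a _) = a

data Increasing {m : ℕ} : LTree (Subset m) → Set where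
  inc : ∀ {s cs} →
        All (λ c → ∀ (i j : Fin m) → i ∈ s → j ∈ rootLabel c → toℕ i < toℕ j) cs →
        All Increasing cs →
        Increasing (lnode s cs)

-- Increasing k-labelling of T with label set Fin (k * n), n = size T
-- (Fin (k*n) = {0,…,kn-1} stands for {1,…,kn} via i ↦ i+1).
IsIncreasingLabelling : (k : ℕ) (T : Tree) → LTree (Subset (k * size T)) → Set
IsIncreasingLabelling k T t =
  shape t ≡ T ×
  All (λ s → ∣ s ∣ ≡ k) (labels t) ×
  AllPairs (λ a b → a ∩ b ≡ ⊥) (labels t) ×
  Increasing t

-- In an increasing k-labelling of T drawn from a label set S with ∣ S ∣ = k ∣ T ∣, every
-- label not at the root sits at a descendant of the root, and every node carries at least
-- one label; hence the root's labels are forced to be the k smallest elements of S.  The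
-- other labels are shared out among the subtrees: the first subtree receives an arbitrary
-- subset of S of the right size, the remaining forest its complement.  Enumerating the
-- labellings along this recursion gives a duplicate-free list whose length L satisfies
--   L (node ts) = L ts   and   L (t ∷ ts) = C (a + b) a · L t · L ts   (a = k ∣ t ∣, b = k ∣ ts ∣),
-- so that (m + n)↓m · n! = (m + n)! and C (a + b) a · a! · b! = (a + b)! give
-- L T · ∏ (k h_v)↓k = (k ∣ T ∣)! by induction on T.

module Submission where

open import Defs
open import Algebra.Properties.CommutativeSemigroup using (interchange; x∙yz≈y∙xz)
open import Data.Nat using (ℕ; zero; suc; _+_; _*_; _∸_; _≤_; _<_; _!; z≤n; s≤s)
open import Data.Nat.Properties
open import Data.Nat.Combinatorics using (_C_; nCk+nC[k+1]≡[n+1]C[k+1]; nCk≡n!/k![n-k]!; k![n∸k]!∣n!)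
open import Data.Nat.DivMod using (_/_; m/n*n≡m)
open import Data.Fin using (Fin; toℕ; zero; suc)
open import Data.Fin.Subset as Subset
  using (Subset; _∉_; _⊆_; _∩_; _∪_; _─_; ⋃; ∣_∣; ⊥; ⊤; inside; outside; Nonempty)
  renaming (_∈_ to _∈ˢ_)
open import Data.Fin.Subset.Properties
open import Data.Vec using ([]; _∷_; here; there)
open import Data.Vec.Properties using (∷-injectiveʳ)
open import Data.List using (List; []; _∷_; _++_; [_]; length; map; concatMap; cartesianProductWith)
open import Data.List.Properties using (length-map; length-++; ∷-injective)
open import Data.List.Membership.Propositional using (_∈_; find; lose)
open import Data.List.Membership.Propositional.Properties
  using (∈-map⁺; ∈-map⁻; ∈-++⁺ˡ; ∈-++⁺ʳ; ∈-++⁻; ∈-concatMap⁺; ∈-concatMap⁻;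
         ∈-cartesianProductWith⁺; ∈-cartesianProductWith⁻)
open import Data.List.Relation.Unary.Any using (here; there)
open import Data.List.Relation.Unary.All using (All; []; _∷_)
import Data.List.Relation.Unary.All as All using (map; lookup; tabulate)
import Data.List.Relation.Unary.All.Properties as All
open import Data.List.Relation.Unary.AllPairs using (AllPairs; []; _∷_)
import Data.List.Relation.Unary.AllPairs.Properties as AllPairs
open import Data.List.Relation.Unary.Unique.Propositional using (Unique)
import Data.List.Relation.Unary.Unique.Propositional.Properties as Unique
open import Data.Product using (∃; _×_; _,_)
open import Data.Sum using (inj₁; inj₂)
open import Function using (_∘_; case_of_)
open import Function.Bundles using (_⇔_; mk⇔)
open import Relation.Nullary using (yes; no; contradiction)
open import Relation.Binary.PropositionalEquality hiding ([_])

private variable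
  n : ℕ
  p q r u : Subset n
  x : Fin n
  a : Subset n
  L L₁ L₂ : List (Subset n)
  k : ℕ

[m+n]↓m*n!≡[m+n]! : ∀ m n → (m + n) ↓ m * n ! ≡ (m + n) !
[m+n]↓m*n!≡[m+n]! zero    n = +-identityʳ (n !)
[m+n]↓m*n!≡[m+n]! (suc m) n =
  trans (*-assoc (suc (m + n)) ((m + n) ↓ m) (n !)) (cong (suc (m + n) *_) ([m+n]↓m*n!≡[m+n]! m n))

[m+n]Cm*[m!*n!]≡[m+n]! : ∀ m n → ((m + n) C m) * (m ! * n !) ≡ (m + n) !
[m+n]Cm*[m!*n!]≡[m+n]! m n = begin
  ((m + n) C m) * (m ! * n !)            ≡⟨ cong (λ d → ((m + n) C m) * (m ! * d !)) (m+n∸m≡n m n) ⟨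
  ((m + n) C m) * (m ! * (m + n ∸ m) !)  ≡⟨ cong (_* (m ! * (m + n ∸ m) !)) (nCk≡n!/k![n-k]! (m≤m+n m n)) ⟩
  (m + n) ! / (m ! * (m + n ∸ m) !) * _  ≡⟨ m/n*n≡m (k![n∸k]!∣n! (m≤m+n m n)) ⟩
  (m + n) !                              ∎
  where
  open ≡-Reasoning
  instance _ = m !* (m + n ∸ m) !≢0

AllPairs-++⁻ : ∀ {A : Set} {R : A → A → Set} xs {ys} → AllPairs R (xs ++ ys) →
               AllPairs R xs × AllPairs R ys × All (λ x → All (R x) ys) xs
AllPairs-++⁻ []       rs         = [] , rs , []
AllPairs-++⁻ (x ∷ xs) (rx ∷ rs) =
  let rxs , rys , cross = AllPairs-++⁻ xs rs
      rx-xs , rx-ys     = All.++⁻ xs rx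
  in  rx-xs ∷ rxs , rys , rx-ys ∷ cross

module _ {A B : Set} (f : A → List B) where

  length-concatMap : ∀ xs {c d} → (∀ {x} → x ∈ xs → length (f x) * c ≡ d) →
                     length (concatMap f xs) * c ≡ length xs * d
  length-concatMap []       _ = refl
  length-concatMap (x ∷ xs) {c} {d} len = begin
    length (f x ++ concatMap f xs) * c              ≡⟨ cong (_* c) (length-++ (f x)) ⟩
    (length (f x) + length (concatMap f xs)) * c    ≡⟨ *-distribʳ-+ c (length (f x)) _ ⟩
    length (f x) * c + length (concatMap f xs) * c  ≡⟨ cong₂ _+_ (len (here refl)) (length-concatMap xs (len ∘ there)) ⟩
    d + length xs * d                               ∎
    where open ≡-Reasoning

  concatMap-unique : ∀ {xs} → Unique xs → (∀ {x} → x ∈ xs → Unique (f x)) →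
                     (g : B → A) → (∀ {x y} → x ∈ xs → y ∈ f x → g y ≡ x) → Unique (concatMap f xs)
  concatMap-unique []               _    _ _      = []
  concatMap-unique (x∉xs ∷ uniqueXs) uniq g g∘f≡id =
    Unique.++⁺ (uniq (here refl)) (concatMap-unique uniqueXs (uniq ∘ there) g (g∘f≡id ∘ there)) λ (y∈fx , y∈rest) →
      let x′ , x′∈xs , y∈fx′ = find (∈-concatMap⁻ f y∈rest)
      in  All.lookup x∉xs x′∈xs (trans (sym (g∘f≡id (here refl) y∈fx)) (g∘f≡id (there x′∈xs) y∈fx′))

length-cartesianProductWith : ∀ {A B C : Set} (f : A → B → C) xs ys →
                              length (cartesianProductWith f xs ys) ≡ length xs * length ys
length-cartesianProductWith f []       ys = refl
length-cartesianProductWith f (x ∷ xs) ys = begin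
  length (map (f x) ys ++ cartesianProductWith f xs ys)          ≡⟨ length-++ (map (f x) ys) ⟩
  length (map (f x) ys) + length (cartesianProductWith f xs ys)  ≡⟨ cong₂ _+_ (length-map (f x) ys) (length-cartesianProductWith f xs ys) ⟩
  length ys + length xs * length ys                              ∎
  where open ≡-Reasoning

∩≡⊥⇒∉ : p ∩ q ≡ ⊥ → x ∈ˢ p → x ∉ q
∩≡⊥⇒∉ p∩q≡⊥ x∈p x∈q = ∉⊥ (subst (_ ∈ˢ_) p∩q≡⊥ (x∈p∩q⁺ (x∈p , x∈q)))

∩≡⊥-antimono : p ⊆ r → q ⊆ u → r ∩ u ≡ ⊥ → p ∩ q ≡ ⊥
∩≡⊥-antimono {p = p} {q = q} p⊆r q⊆u r∩u≡⊥ = Empty-unique λ (_ , x∈p∩q) →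
  let x∈p , x∈q = x∈p∩q⁻ p q x∈p∩q in ∩≡⊥⇒∉ r∩u≡⊥ (p⊆r x∈p) (q⊆u x∈q)

p∩[q─p]≡⊥ : ∀ (p q : Subset n) → p ∩ (q ─ p) ≡ ⊥
p∩[q─p]≡⊥ []            []      = refl
p∩[q─p]≡⊥ (inside  ∷ p) (_ ∷ q) = cong (outside ∷_) (p∩[q─p]≡⊥ p q)
p∩[q─p]≡⊥ (outside ∷ p) (_ ∷ q) = cong (outside ∷_) (p∩[q─p]≡⊥ p q)

p⊆q⇒p∪[q─p]≡q : p ⊆ q → p ∪ (q ─ p) ≡ q
p⊆q⇒p∪[q─p]≡q {p = []}          {q = []}          _   = refl
p⊆q⇒p∪[q─p]≡q {p = inside  ∷ p} {q = inside  ∷ q} p⊆q = cong (inside ∷_) (p⊆q⇒p∪[q─p]≡q (drop-∷-⊆ p⊆q))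
p⊆q⇒p∪[q─p]≡q {p = inside  ∷ p} {q = outside ∷ q} p⊆q = contradiction (p⊆q here) λ ()
p⊆q⇒p∪[q─p]≡q {p = outside ∷ p} {q = s ∷ q}       p⊆q = cong (s ∷_) (p⊆q⇒p∪[q─p]≡q (drop-∷-⊆ p⊆q))

p∩q≡⊥⇒[p∪q]─p≡q : p ∩ q ≡ ⊥ → (p ∪ q) ─ p ≡ q
p∩q≡⊥⇒[p∪q]─p≡q {p = []}          {q = []}          _ = refl
p∩q≡⊥⇒[p∪q]─p≡q {p = inside  ∷ p} {q = outside ∷ q} e = cong (outside ∷_) (p∩q≡⊥⇒[p∪q]─p≡q (∷-injectiveʳ e))
p∩q≡⊥⇒[p∪q]─p≡q {p = outside ∷ p} {q = s ∷ q}       e = cong (s ∷_) (p∩q≡⊥⇒[p∪q]─p≡q (∷-injectiveʳ e))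

p∩q≡⊥⇒∣p∪q∣≡∣p∣+∣q∣ : p ∩ q ≡ ⊥ → ∣ p ∪ q ∣ ≡ ∣ p ∣ + ∣ q ∣
p∩q≡⊥⇒∣p∪q∣≡∣p∣+∣q∣ {p = []}          {q = []}          _ = refl
p∩q≡⊥⇒∣p∪q∣≡∣p∣+∣q∣ {p = inside  ∷ p} {q = outside ∷ q} e = cong suc (p∩q≡⊥⇒∣p∪q∣≡∣p∣+∣q∣ (∷-injectiveʳ e))
p∩q≡⊥⇒∣p∪q∣≡∣p∣+∣q∣ {p = outside ∷ p} {q = inside  ∷ q} e =
  trans (cong suc (p∩q≡⊥⇒∣p∪q∣≡∣p∣+∣q∣ (∷-injectiveʳ e))) (sym (+-suc _ _))
p∩q≡⊥⇒∣p∪q∣≡∣p∣+∣q∣ {p = outside ∷ p} {q = outside ∷ q} e = p∩q≡⊥⇒∣p∪q∣≡∣p∣+∣q∣ (∷-injectiveʳ e)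

∣p∣≡0⇒p≡⊥ : ∣ p ∣ ≡ 0 → p ≡ ⊥
∣p∣≡0⇒p≡⊥ {p = p} ∣p∣≡0 = Empty-unique λ (x , x∈p) →
  n≮0 (subst (∣ p Subset.- x ∣ <_) ∣p∣≡0 (x∈p⇒∣p-x∣<∣p∣ x∈p))

0<∣p∣⇒Nonempty : ∀ {n} {p : Subset n} → 0 < ∣ p ∣ → Nonempty p
0<∣p∣⇒Nonempty {n} {p} 0<∣p∣ with nonempty? p
... | yes ne = ne
... | no ¬ne = contradiction (trans (cong ∣_∣ (Empty-unique ¬ne)) (∣⊥∣≡0 n)) (>⇒≢ 0<∣p∣)

p⊆q⇒∣q─p∣≡∣q∣∸∣p∣ : p ⊆ q → ∣ q ─ p ∣ ≡ ∣ q ∣ ∸ ∣ p ∣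
p⊆q⇒∣q─p∣≡∣q∣∸∣p∣ {p = p} {q = q} p⊆q = begin
  ∣ q ─ p ∣                   ≡⟨ m+n∸m≡n ∣ p ∣ ∣ q ─ p ∣ ⟨
  ∣ p ∣ + ∣ q ─ p ∣ ∸ ∣ p ∣   ≡⟨ cong (_∸ ∣ p ∣) (p∩q≡⊥⇒∣p∪q∣≡∣p∣+∣q∣ (p∩[q─p]≡⊥ p q)) ⟨
  ∣ p ∪ (q ─ p) ∣ ∸ ∣ p ∣     ≡⟨ cong (λ r → ∣ r ∣ ∸ ∣ p ∣) (p⊆q⇒p∪[q─p]≡q p⊆q) ⟩
  ∣ q ∣ ∸ ∣ p ∣               ∎
  where open ≡-Reasoning

⋃-++ : ∀ (L₁ L₂ : List (Subset n)) → ⋃ (L₁ ++ L₂) ≡ ⋃ L₁ ∪ ⋃ L₂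
⋃-++ []       L₂ = sym (∪-identityˡ (⋃ L₂))
⋃-++ (a ∷ L₁) L₂ = trans (cong (a ∪_) (⋃-++ L₁ L₂)) (sym (∪-assoc a (⋃ L₁) (⋃ L₂)))

∈⇒⊆⋃ : a ∈ L → a ⊆ ⋃ L
∈⇒⊆⋃ {L = _ ∷ L} (here refl) = p⊆p∪q (⋃ L)
∈⇒⊆⋃ {L = b ∷ L} (there a∈L) = q⊆p∪q b (⋃ L) ∘ ∈⇒⊆⋃ a∈L

∩⋃≡⊥ : All (λ b → a ∩ b ≡ ⊥) L → a ∩ ⋃ L ≡ ⊥
∩⋃≡⊥ {a = a} []                   = ∩-zeroʳ a
∩⋃≡⊥ {a = a} {L = b ∷ L} (e ∷ es) = begin
  a ∩ (b ∪ ⋃ L)         ≡⟨ ∩-distribˡ-∪ a b (⋃ L) ⟩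
  (a ∩ b) ∪ (a ∩ ⋃ L)   ≡⟨ cong₂ _∪_ e (∩⋃≡⊥ es) ⟩
  ⊥ ∪ ⊥                 ≡⟨ ∪-identityˡ ⊥ ⟩
  ⊥                     ∎
  where open ≡-Reasoning

⋃∩⋃≡⊥ : All (λ a → All (λ b → a ∩ b ≡ ⊥) L₂) L₁ → ⋃ L₁ ∩ ⋃ L₂ ≡ ⊥
⋃∩⋃≡⊥ {L₂ = L₂} []                    = ∩-zeroˡ (⋃ L₂)
⋃∩⋃≡⊥ {L₂ = L₂} {L₁ = a ∷ L₁} (e ∷ es) = begin
  (a ∪ ⋃ L₁) ∩ ⋃ L₂           ≡⟨ ∩-distribʳ-∪ (⋃ L₂) a (⋃ L₁) ⟩
  (a ∩ ⋃ L₂) ∪ (⋃ L₁ ∩ ⋃ L₂)  ≡⟨ cong₂ _∪_ (∩⋃≡⊥ e) (⋃∩⋃≡⊥ es) ⟩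
  ⊥ ∪ ⊥                       ≡⟨ ∪-identityˡ ⊥ ⟩
  ⊥                           ∎
  where open ≡-Reasoning

∣⋃∣≡k*length : ∀ {n k} {L : List (Subset n)} → All (λ a → ∣ a ∣ ≡ k) L → AllPairs (λ a b → a ∩ b ≡ ⊥) L →
               ∣ ⋃ L ∣ ≡ k * length L
∣⋃∣≡k*length {n} {k} [] [] = trans (∣⊥∣≡0 n) (sym (*-zeroʳ k))
∣⋃∣≡k*length {k = k} {L = a ∷ L} (e ∷ es) (d ∷ ds) = begin
  ∣ a ∪ ⋃ L ∣          ≡⟨ p∩q≡⊥⇒∣p∪q∣≡∣p∣+∣q∣ (∩⋃≡⊥ d) ⟩
  ∣ a ∣ + ∣ ⋃ L ∣      ≡⟨ cong₂ _+_ e (∣⋃∣≡k*length es ds) ⟩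
  k + k * length L     ≡⟨ *-suc k (length L) ⟨
  k * suc (length L)   ∎
  where open ≡-Reasoning

-- Partitions into blocks of size k

record IsPartition (k : ℕ) (S : Subset n) (L : List (Subset n)) : Set where
  field
    blockSizes : All (λ a → ∣ a ∣ ≡ k) L
    disjoint   : AllPairs (λ a b → a ∩ b ≡ ⊥) L
    ⋃L≡S       : ⋃ L ≡ S

open IsPartition

partition⇒∣S∣≡k*length : ∀ {S : Subset n} → IsPartition k S L → ∣ S ∣ ≡ k * length L
partition⇒∣S∣≡k*length P = trans (cong ∣_∣ (sym (⋃L≡S P))) (∣⋃∣≡k*length (blockSizes P) (disjoint P))

partition-⊤ : ∀ {n k} {L : List (Subset n)} → All (λ a → ∣ a ∣ ≡ k) L → AllPairs (λ a b → a ∩ b ≡ ⊥) L →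
              k * length L ≡ n → IsPartition k ⊤ L
partition-⊤ sizes≡k pairwiseDisjoint k*length≡n = record
  { blockSizes = sizes≡k
  ; disjoint   = pairwiseDisjoint
  ; ⋃L≡S       = ∣p∣≡n⇒p≡⊤ (trans (∣⋃∣≡k*length sizes≡k pairwiseDisjoint) k*length≡n)
  }

partition-++⁺ : ∀ {S A : Subset n} → A ⊆ S →
                IsPartition k A L₁ → IsPartition k (S ─ A) L₂ → IsPartition k S (L₁ ++ L₂)
partition-++⁺ {L₁ = L₁} {L₂ = L₂} {S = S} {A = A} A⊆S P₁ P₂ = record
  { blockSizes = All.++⁺ (blockSizes P₁) (blockSizes P₂)
  ; disjoint   = AllPairs.++⁺ (disjoint P₁) (disjoint P₂) (All.tabulate λ a∈L₁ → All.tabulate λ b∈L₂ →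
                   ∩≡⊥-antimono (⊆-in P₁ a∈L₁) (⊆-in P₂ b∈L₂) (p∩[q─p]≡⊥ A S))
  ; ⋃L≡S       = begin
      ⋃ (L₁ ++ L₂)      ≡⟨ ⋃-++ L₁ L₂ ⟩
      ⋃ L₁ ∪ ⋃ L₂       ≡⟨ cong₂ _∪_ (⋃L≡S P₁) (⋃L≡S P₂) ⟩
      A ∪ (S ─ A)       ≡⟨ p⊆q⇒p∪[q─p]≡q A⊆S ⟩
      S                 ∎
  }
  where
  open ≡-Reasoning
  ⊆-in : ∀ {B L} → IsPartition k B L → a ∈ L → a ⊆ B
  ⊆-in P a∈L = subst (_ ⊆_) (⋃L≡S P) (∈⇒⊆⋃ a∈L)

partition-++⁻ : ∀ {S : Subset n} → IsPartition k S (L₁ ++ L₂) →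
                ⋃ L₁ ⊆ S × IsPartition k (⋃ L₁) L₁ × IsPartition k (S ─ ⋃ L₁) L₂
partition-++⁻ {L₁ = L₁} {L₂ = L₂} {S = S} P
  with sizes₁ , sizes₂ ← All.++⁻ L₁ (blockSizes P)
  with disjoint₁ , disjoint₂ , cross ← AllPairs-++⁻ L₁ (disjoint P) =
  subst (⋃ L₁ ⊆_) ⋃₁∪⋃₂≡S (p⊆p∪q (⋃ L₂)) ,
  record { blockSizes = sizes₁ ; disjoint = disjoint₁ ; ⋃L≡S = refl } ,
  record { blockSizes = sizes₂ ; disjoint = disjoint₂ ; ⋃L≡S = ⋃₂≡S─⋃₁ }
  where
  ⋃₁∪⋃₂≡S : ⋃ L₁ ∪ ⋃ L₂ ≡ S
  ⋃₁∪⋃₂≡S = trans (sym (⋃-++ L₁ L₂)) (⋃L≡S P)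
  ⋃₂≡S─⋃₁ : ⋃ L₂ ≡ S ─ ⋃ L₁
  ⋃₂≡S─⋃₁ = trans (sym (p∩q≡⊥⇒[p∪q]─p≡q (⋃∩⋃≡⊥ cross))) (cong (_─ ⋃ L₁) ⋃₁∪⋃₂≡S)

partition-∷⁺ : ∀ {S : Subset n} → a ⊆ S → ∣ a ∣ ≡ k → IsPartition k (S ─ a) L → IsPartition k S (a ∷ L)
partition-∷⁺ {a = a} a⊆S ∣a∣≡k = partition-++⁺ a⊆S
  (record { blockSizes = ∣a∣≡k ∷ [] ; disjoint = [] ∷ [] ; ⋃L≡S = ∪-identityʳ a })

partition-∷⁻ : ∀ {S : Subset n} → IsPartition k S (a ∷ L) → a ⊆ S × ∣ a ∣ ≡ k × IsPartition k (S ─ a) L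
partition-∷⁻ {a = a} P with a⊆S , _ , P′ ← partition-++⁻ {L₁ = [ a ]} P rewrite ∪-identityʳ a =
  a⊆S , All.head (blockSizes P) , P′

infix 4 _≺_
_≺_ : Subset n → Subset n → Set
p ≺ q = ∀ i j → i ∈ˢ p → j ∈ˢ q → toℕ i < toℕ j

≺-anti-monoʳ : q ⊆ r → p ≺ r → p ≺ q
≺-anti-monoʳ q⊆r p≺r i j i∈p j∈q = p≺r i j i∈p (q⊆r j∈q)

≺-trans : Nonempty q → p ≺ q → q ≺ r → p ≺ r
≺-trans (y , y∈q) p≺q q≺r i j i∈p j∈r = <-trans (p≺q i y i∈p y∈q) (q≺r y j y∈q j∈r)

≺-⋃ : All (p ≺_) L → p ≺ ⋃ L
≺-⋃ []                         i j i∈p j∈⊥ = contradiction j∈⊥ ∉⊥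
≺-⋃ {L = a ∷ L} (p≺a ∷ p≺L) i j i∈p j∈⋃ with x∈p∪q⁻ a (⋃ L) j∈⋃
... | inj₁ j∈a = p≺a i j i∈p j∈a
... | inj₂ j∈⋃L = ≺-⋃ p≺L i j i∈p j∈⋃L

-- The m smallest elements of s, or all of s when ∣ s ∣ < m.
least : ℕ → Subset n → Subset n
least zero    _             = ⊥
least (suc m) []            = []
least (suc m) (outside ∷ s) = outside ∷ least (suc m) s
least (suc m) (inside  ∷ s) = inside ∷ least m s

least-outside : ∀ m (s : Subset n) → least m (outside ∷ s) ≡ outside ∷ least m s
least-outside zero    _ = refl
least-outside (suc m) _ = refl

least-⊆ : ∀ m (s : Subset n) → least m s ⊆ s
least-⊆ zero    s             x∈⊥         = contradiction x∈⊥ ∉⊥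
least-⊆ (suc m) (outside ∷ s) (there x∈l) = there (least-⊆ (suc m) s x∈l)
least-⊆ (suc m) (inside  ∷ s) here        = here
least-⊆ (suc m) (inside  ∷ s) (there x∈l) = there (least-⊆ m s x∈l)

∣least∣ : ∀ m (s : Subset n) → m ≤ ∣ s ∣ → ∣ least m s ∣ ≡ m
∣least∣ {n} zero s _ = ∣⊥∣≡0 n
∣least∣ (suc m) (outside ∷ s) m<∣s∣     = ∣least∣ (suc m) s m<∣s∣
∣least∣ (suc m) (inside  ∷ s) (s≤s m≤) = cong suc (∣least∣ m s m≤)

least≺rest : ∀ m (s : Subset n) → least m s ≺ s ─ least m s
least≺rest zero    s             i       j       i∈⊥         _           = contradiction i∈⊥ ∉⊥
least≺rest (suc m) (outside ∷ s) (suc i) (suc j) (there i∈l) (there j∈r) = s≤s (least≺rest (suc m) s i j i∈l j∈r)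
least≺rest (suc m) (inside  ∷ s) zero    (suc j) here        _           = s≤s z≤n
least≺rest (suc m) (inside  ∷ s) (suc i) (suc j) (there i∈l) (there j∈r) = s≤s (least≺rest m s i j i∈l j∈r)

least-unique : ∀ (r s : Subset n) → r ⊆ s → r ≺ s ─ r → r ≡ least ∣ r ∣ s
least-unique []            []            _   _   = refl
least-unique (inside  ∷ r) (inside  ∷ s) r⊆s r≺ =
  cong (inside ∷_) (least-unique r s (drop-∷-⊆ r⊆s) λ i j i∈r j∈ → ≤-pred (r≺ (suc i) (suc j) (there i∈r) (there j∈)))
least-unique (inside  ∷ r) (outside ∷ s) r⊆s _   = contradiction (r⊆s here) λ ()
least-unique (outside ∷ r) (outside ∷ s) r⊆s r≺ =
  trans (cong (outside ∷_) (least-unique r s (drop-∷-⊆ r⊆s) λ i j i∈r j∈ → ≤-pred (r≺ (suc i) (suc j) (there i∈r) (there j∈))))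
        (sym (least-outside ∣ r ∣ s))
least-unique {n = suc n} (outside ∷ r) (inside  ∷ s) _ r≺
  rewrite Empty-unique {p = r} (λ (i , i∈r) → contradiction (r≺ (suc i) zero (there i∈r) here) λ ())
        | ∣⊥∣≡0 n = refl

subsetsOfSize : Subset n → ℕ → List (Subset n)
subsetsOfSize _             zero    = [ ⊥ ]
subsetsOfSize []            (suc m) = []
subsetsOfSize (outside ∷ s) (suc m) = map (outside ∷_) (subsetsOfSize s (suc m))
subsetsOfSize (inside  ∷ s) (suc m) = map (inside ∷_) (subsetsOfSize s m) ++ map (outside ∷_) (subsetsOfSize s (suc m))

∈-subsetsOfSize⁻ : ∀ m (s : Subset n) → a ∈ subsetsOfSize s m → a ⊆ s × ∣ a ∣ ≡ m
∈-subsetsOfSize⁻ {n = n} zero s (here refl) = ⊆-min s , ∣⊥∣≡0 n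
∈-subsetsOfSize⁻ (suc m) (outside ∷ s) a∈ with _ , a∈′ , refl ← ∈-map⁻ (outside ∷_) a∈ =
  let a⊆s , ∣a∣≡m = ∈-subsetsOfSize⁻ (suc m) s a∈′ in out⊆ a⊆s , ∣a∣≡m
∈-subsetsOfSize⁻ (suc m) (inside ∷ s) a∈ with ∈-++⁻ (map (inside ∷_) (subsetsOfSize s m)) a∈
... | inj₁ a∈ᵢ with _ , a∈′ , refl ← ∈-map⁻ (inside ∷_) a∈ᵢ =
  let a⊆s , ∣a∣≡m = ∈-subsetsOfSize⁻ m s a∈′ in in⊆in a⊆s , cong suc ∣a∣≡m
... | inj₂ a∈ₒ with _ , a∈′ , refl ← ∈-map⁻ (outside ∷_) a∈ₒ =
  let a⊆s , ∣a∣≡m = ∈-subsetsOfSize⁻ (suc m) s a∈′ in out⊆ a⊆s , ∣a∣≡m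

∈-subsetsOfSize⁺ : ∀ m {a s : Subset n} → a ⊆ s → ∣ a ∣ ≡ m → a ∈ subsetsOfSize s m
∈-subsetsOfSize⁺ zero    _ ∣a∣≡0 = here (∣p∣≡0⇒p≡⊥ ∣a∣≡0)
∈-subsetsOfSize⁺ (suc m) {inside  ∷ a} {inside  ∷ s} a⊆s ∣a∣≡m =
  ∈-++⁺ˡ (∈-map⁺ (inside ∷_) (∈-subsetsOfSize⁺ m (drop-∷-⊆ a⊆s) (suc-injective ∣a∣≡m)))
∈-subsetsOfSize⁺ (suc m) {outside ∷ a} {inside  ∷ s} a⊆s ∣a∣≡m =
  ∈-++⁺ʳ (map (inside ∷_) (subsetsOfSize s m)) (∈-map⁺ (outside ∷_) (∈-subsetsOfSize⁺ (suc m) (drop-∷-⊆ a⊆s) ∣a∣≡m))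
∈-subsetsOfSize⁺ (suc m) {outside ∷ a} {outside ∷ s} a⊆s ∣a∣≡m =
  ∈-map⁺ (outside ∷_) (∈-subsetsOfSize⁺ (suc m) (drop-∷-⊆ a⊆s) ∣a∣≡m)
∈-subsetsOfSize⁺ (suc m) {inside  ∷ a} {outside ∷ s} a⊆s _ = contradiction (a⊆s here) λ ()

subsetsOfSize-unique : ∀ (s : Subset n) m → Unique (subsetsOfSize s m)
subsetsOfSize-unique _             zero    = [] ∷ []
subsetsOfSize-unique []            (suc m) = []
subsetsOfSize-unique (outside ∷ s) (suc m) = Unique.map⁺ ∷-injectiveʳ (subsetsOfSize-unique s (suc m))
subsetsOfSize-unique (inside  ∷ s) (suc m) = Unique.++⁺
  (Unique.map⁺ ∷-injectiveʳ (subsetsOfSize-unique s m))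
  (Unique.map⁺ ∷-injectiveʳ (subsetsOfSize-unique s (suc m)))
  λ (a∈ᵢ , a∈ₒ) → case ∈-map⁻ (inside ∷_) a∈ᵢ , ∈-map⁻ (outside ∷_) a∈ₒ of λ where
    ((_ , _ , refl) , (_ , _ , ()))

length-subsetsOfSize : ∀ (s : Subset n) m → length (subsetsOfSize s m) ≡ ∣ s ∣ C m
length-subsetsOfSize _             zero    = refl
length-subsetsOfSize []            (suc m) = refl
length-subsetsOfSize (outside ∷ s) (suc m) =
  trans (length-map (outside ∷_) (subsetsOfSize s (suc m))) (length-subsetsOfSize s (suc m))
length-subsetsOfSize (inside  ∷ s) (suc m) = begin
  length (map (inside ∷_) (subsetsOfSize s m) ++ map (outside ∷_) (subsetsOfSize s (suc m)))
    ≡⟨ length-++ (map (inside ∷_) (subsetsOfSize s m)) ⟩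
  length (map (inside ∷_) (subsetsOfSize s m)) + length (map (outside ∷_) (subsetsOfSize s (suc m)))
    ≡⟨ cong₂ _+_ (length-map (inside ∷_) (subsetsOfSize s m)) (length-map (outside ∷_) (subsetsOfSize s (suc m))) ⟩
  length (subsetsOfSize s m) + length (subsetsOfSize s (suc m))
    ≡⟨ cong₂ _+_ (length-subsetsOfSize s m) (length-subsetsOfSize s (suc m)) ⟩
  ∣ s ∣ C m + ∣ s ∣ C suc m
    ≡⟨ nCk+nC[k+1]≡[n+1]C[k+1] ∣ s ∣ m ⟩
  suc ∣ s ∣ C suc m ∎
  where open ≡-Reasoning

mutual
  length-labels : ∀ {A : Set} (c : LTree A) → length (labels c) ≡ size (shape c)
  length-labels (lnode _ cs) = cong suc (length-labelsL cs)

  length-labelsL : ∀ {A : Set} (cs : List (LTree A)) → length (labelsL cs) ≡ sizes (shapes cs)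
  length-labelsL []       = refl
  length-labelsL (c ∷ cs) = trans (length-++ (labels c)) (cong₂ _+_ (length-labels c) (length-labelsL cs))

rootLabel∈labelsL : ∀ {A : Set} (cs : List (LTree A)) → All (λ c → rootLabel c ∈ labelsL cs) cs
rootLabel∈labelsL []                  = []
rootLabel∈labelsL (lnode a cs′ ∷ cs) = here refl ∷ All.map (∈-++⁺ʳ (a ∷ labelsL cs′)) (rootLabel∈labelsL cs)

-- Transitivity passes through the intermediate labels, which therefore must be non-empty.
≺-labelsL : ∀ {R : Subset n} (cs : List (LTree (Subset n))) → All (λ c → R ≺ rootLabel c) cs →
            All Increasing cs → All Nonempty (labelsL cs) → All (R ≺_) (labelsL cs)
≺-labelsL []                 []           []                      _  = []
≺-labelsL (lnode R′ cs′ ∷ cs) (R≺R′ ∷ R≺) (inc R′≺ incs′ ∷ incs) ne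
  with ne′ , ne-rest ← All.++⁻ (R′ ∷ labelsL cs′) ne =
  All.++⁺ (R≺R′ ∷ All.map (≺-trans (All.head ne′) R≺R′) (≺-labelsL cs′ R′≺ incs′ (All.tail ne′)))
          (≺-labelsL cs R≺ incs ne-rest)

-- Enumerating increasing labellings

module Labellings (k : ℕ) {N : ℕ} where

  Labelling : Set
  Labelling = LTree (Subset N)

  mutual
    labellings : Tree → Subset N → List Labelling
    labellings (node ts) S = map (lnode (least k S)) (forestLabellings ts (S ─ least k S))

    forestLabellings : List Tree → Subset N → List (List Labelling)
    forestLabellings []       _ = [ [] ]
    forestLabellings (t ∷ ts) S = concatMap (extensions t ts S) (subsetsOfSize S (k * size t))

    extensions : Tree → List Tree → Subset N → Subset N → List (List Labelling)
    extensions t ts S A = cartesianProductWith _∷_ (labellings t A) (forestLabellings ts (S ─ A))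

  IsLabelling : Tree → Subset N → Labelling → Set
  IsLabelling T S c = shape c ≡ T × Increasing c × IsPartition k S (labels c)

  IsForestLabelling : List Tree → Subset N → List Labelling → Set
  IsForestLabelling ts S cs = shapes cs ≡ ts × All Increasing cs × IsPartition k S (labelsL cs)

  ∣S─A∣≡k*b : ∀ (S A : Subset N) a b → A ⊆ S → ∣ A ∣ ≡ k * a → ∣ S ∣ ≡ k * (a + b) → ∣ S ─ A ∣ ≡ k * b
  ∣S─A∣≡k*b S A a b A⊆S ∣A∣≡ ∣S∣≡ = begin
    ∣ S ─ A ∣                ≡⟨ p⊆q⇒∣q─p∣≡∣q∣∸∣p∣ A⊆S ⟩
    ∣ S ∣ ∸ ∣ A ∣            ≡⟨ cong₂ _∸_ (trans ∣S∣≡ (*-distribˡ-+ k a b)) ∣A∣≡ ⟩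
    k * a + k * b ∸ k * a    ≡⟨ m+n∸m≡n (k * a) (k * b) ⟩
    k * b                    ∎
    where open ≡-Reasoning

  ∣least∣≡k : ∀ (S : Subset N) s → ∣ S ∣ ≡ k * suc s → ∣ least k S ∣ ≡ k
  ∣least∣≡k S s ∣S∣≡ = ∣least∣ k S (subst (k ≤_) (sym (trans ∣S∣≡ (*-suc k s))) (m≤m+n k (k * s)))

  ∣S─least∣≡k*s : ∀ (S : Subset N) s → ∣ S ∣ ≡ k * suc s → ∣ S ─ least k S ∣ ≡ k * s
  ∣S─least∣≡k*s S s ∣S∣≡ =
    ∣S─A∣≡k*b S (least k S) 1 s (least-⊆ k S) (trans (∣least∣≡k S s ∣S∣≡) (sym (*-identityʳ k))) ∣S∣≡

  mutual
    labellings-sound : ∀ T {S c} → c ∈ labellings T S → ∣ S ∣ ≡ k * size T → IsLabelling T S c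
    labellings-sound (node ts) {S} c∈ ∣S∣≡ with cs , cs∈ , refl ← ∈-map⁻ (lnode (least k S)) c∈ =
      let shape≡ , incs , P = forestLabellings-sound ts cs∈ (∣S─least∣≡k*s S (sizes ts) ∣S∣≡)
          R≺roots = All.map (λ root∈ → ≺-anti-monoʳ (subst (_ ⊆_) (⋃L≡S P) (∈⇒⊆⋃ root∈)) (least≺rest k S))
                            (rootLabel∈labelsL cs)
      in  cong node shape≡ , inc R≺roots incs , partition-∷⁺ (least-⊆ k S) (∣least∣≡k S (sizes ts) ∣S∣≡) P

    forestLabellings-sound : ∀ ts {S cs} → cs ∈ forestLabellings ts S → ∣ S ∣ ≡ k * sizes ts →
                             IsForestLabelling ts S cs
    forestLabellings-sound [] (here refl) ∣S∣≡0 =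
      refl , [] , record { blockSizes = [] ; disjoint = [] ; ⋃L≡S = sym (∣p∣≡0⇒p≡⊥ (trans ∣S∣≡0 (*-zeroʳ k))) }
    forestLabellings-sound (t ∷ ts) {S} cs∈ ∣S∣≡
      with A , A∈ , cs∈A ← find (∈-concatMap⁻ (extensions t ts S) {xs = subsetsOfSize S (k * size t)} cs∈)
      with c , cs , c∈ , cs∈′ , refl ← ∈-cartesianProductWith⁻ _∷_ (labellings t A) _ cs∈A
      with A⊆S , ∣A∣≡ ← ∈-subsetsOfSize⁻ _ S A∈ =
      let shape₁ , inc₁ , P₁ = labellings-sound t c∈ ∣A∣≡
          shape₂ , inc₂ , P₂ = forestLabellings-sound ts cs∈′ (∣S─A∣≡k*b S A (size t) (sizes ts) A⊆S ∣A∣≡ ∣S∣≡)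
      in  cong₂ _∷_ shape₁ shape₂ , inc₁ ∷ inc₂ , partition-++⁺ A⊆S P₁ P₂

  module _ (1≤k : 1 ≤ k) where
    mutual
      labellings-complete : ∀ {T S c} → IsLabelling T S c → c ∈ labellings T S
      labellings-complete {S = S} {c = lnode R cs} (refl , inc R≺roots incs , P)
        with R⊆S , ∣R∣≡k , P′ ← partition-∷⁻ P =
        subst (λ R′ → lnode R cs ∈ map (lnode R′) (forestLabellings (shapes cs) (S ─ R′))) R≡least
              (∈-map⁺ (lnode R) (forestLabellings-complete (refl , incs , P′)))
        where
        nonempty : All Nonempty (labelsL cs)
        nonempty = All.map (λ ∣a∣≡k → 0<∣p∣⇒Nonempty (subst (0 <_) (sym ∣a∣≡k) 1≤k)) (blockSizes P′)
        R≺S─R : R ≺ S ─ R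
        R≺S─R = subst (R ≺_) (⋃L≡S P′) (≺-⋃ (≺-labelsL cs R≺roots incs nonempty))
        R≡least : R ≡ least k S
        R≡least = trans (least-unique R S R⊆S R≺S─R) (cong (λ m → least m S) ∣R∣≡k)

      forestLabellings-complete : ∀ {ts S cs} → IsForestLabelling ts S cs → cs ∈ forestLabellings ts S
      forestLabellings-complete {cs = []} (refl , _ , _) = here refl
      forestLabellings-complete {S = S} {cs = c ∷ cs} (refl , inc₁ ∷ inc₂ , P)
        with A⊆S , P₁ , P₂ ← partition-++⁻ {L₁ = labels c} P =
        ∈-concatMap⁺ (extensions (shape c) (shapes cs) S)
          (lose (∈-subsetsOfSize⁺ _ A⊆S ∣A∣≡)
                (∈-cartesianProductWith⁺ _∷_ (labellings-complete (refl , inc₁ , P₁))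
                                             (forestLabellings-complete (refl , inc₂ , P₂))))
        where
        ∣A∣≡ : ∣ ⋃ (labels c) ∣ ≡ k * size (shape c)
        ∣A∣≡ = trans (partition⇒∣S∣≡k*length P₁) (cong (k *_) (length-labels c))

  lnode-injectiveʳ : ∀ {R : Subset N} {cs cs′} → lnode R cs ≡ lnode R cs′ → cs ≡ cs′
  lnode-injectiveʳ refl = refl

  -- Recovers A from any member of extensions t ts S A; the value at [] is never used.
  firstLabels : List Labelling → Subset N
  firstLabels []      = ⊥
  firstLabels (c ∷ _) = ⋃ (labels c)

  mutual
    labellings-unique : ∀ T {S} → ∣ S ∣ ≡ k * size T → Unique (labellings T S)
    labellings-unique (node ts) {S} ∣S∣≡ =
      Unique.map⁺ lnode-injectiveʳ (forestLabellings-unique ts (∣S─least∣≡k*s S (sizes ts) ∣S∣≡))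

    forestLabellings-unique : ∀ ts {S} → ∣ S ∣ ≡ k * sizes ts → Unique (forestLabellings ts S)
    forestLabellings-unique []       _ = [] ∷ []
    forestLabellings-unique (t ∷ ts) {S} ∣S∣≡ =
      concatMap-unique (extensions t ts S) (subsetsOfSize-unique S (k * size t)) extensions-unique
                       firstLabels firstLabels-extensions
      where
      extensions-unique : ∀ {A} → A ∈ subsetsOfSize S (k * size t) → Unique (extensions t ts S A)
      extensions-unique {A} A∈ with A⊆S , ∣A∣≡ ← ∈-subsetsOfSize⁻ _ S A∈ =
        Unique.cartesianProductWith⁺ _∷_ ∷-injective (labellings-unique t ∣A∣≡)
          (forestLabellings-unique ts (∣S─A∣≡k*b S A (size t) (sizes ts) A⊆S ∣A∣≡ ∣S∣≡))
      firstLabels-extensions : ∀ {A cs} → A ∈ subsetsOfSize S (k * size t) → cs ∈ extensions t ts S A →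
                               firstLabels cs ≡ A
      firstLabels-extensions {A} A∈ cs∈
        with _ , ∣A∣≡ ← ∈-subsetsOfSize⁻ (k * size t) S A∈
        with c , _ , c∈ , _ , refl ← ∈-cartesianProductWith⁻ _∷_ (labellings t A) _ cs∈
        with _ , _ , P ← labellings-sound t {A} c∈ ∣A∣≡ = ⋃L≡S P

  mutual
    labellings-count : ∀ T {S} → ∣ S ∣ ≡ k * size T → length (labellings T S) * hookProd k T ≡ (k * size T) !
    labellings-count (node ts) {S} ∣S∣≡ = begin
      length (map (lnode (least k S)) F) * (k[s+1]↓k * hookProds k ts)
        ≡⟨ cong (_* (k[s+1]↓k * hookProds k ts)) (length-map (lnode (least k S)) F) ⟩
      length F * (k[s+1]↓k * hookProds k ts)                             ≡⟨ x∙yz≈y∙xz *-commutativeSemigroup (length F) k[s+1]↓k _ ⟩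
      k[s+1]↓k * (length F * hookProds k ts)                             ≡⟨ cong (k[s+1]↓k *_) (forestLabellings-count ts ∣S─R∣≡) ⟩
      k[s+1]↓k * (k * s) !                                               ≡⟨ k[s+1]↓k*[ks]!≡[k[s+1]]! ⟩
      (k * suc s) !                                                      ∎
      where
      open ≡-Reasoning
      s = sizes ts
      F = forestLabellings ts (S ─ least k S)
      k[s+1]↓k = (k * suc s) ↓ k
      ∣S─R∣≡ = ∣S─least∣≡k*s S s ∣S∣≡
      k[s+1]↓k*[ks]!≡[k[s+1]]! : k[s+1]↓k * (k * s) ! ≡ (k * suc s) !
      k[s+1]↓k*[ks]!≡[k[s+1]]! = subst (λ m → m ↓ k * (k * s) ! ≡ m !) (sym (*-suc k s)) ([m+n]↓m*n!≡[m+n]! k (k * s))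

    forestLabellings-count : ∀ ts {S} → ∣ S ∣ ≡ k * sizes ts →
                             length (forestLabellings ts S) * hookProds k ts ≡ (k * sizes ts) !
    forestLabellings-count []       _ = sym (cong _! (*-zeroʳ k))
    forestLabellings-count (t ∷ ts) {S} ∣S∣≡ = begin
      length (concatMap (extensions t ts S) (subsetsOfSize S kt)) * (hookProd k t * hookProds k ts)
        ≡⟨ length-concatMap (extensions t ts S) (subsetsOfSize S kt) extensions-count ⟩
      length (subsetsOfSize S kt) * (kt ! * kts !)  ≡⟨ cong (_* (kt ! * kts !)) (length-subsetsOfSize S kt) ⟩
      (∣ S ∣ C kt) * (kt ! * kts !)                  ≡⟨ cong (λ m → (m C kt) * (kt ! * kts !)) ∣S∣≡kt+kts ⟩
      ((kt + kts) C kt) * (kt ! * kts !)             ≡⟨ [m+n]Cm*[m!*n!]≡[m+n]! kt kts ⟩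
      (kt + kts) !                                   ≡⟨ cong _! (*-distribˡ-+ k (size t) (sizes ts)) ⟨
      (k * (size t + sizes ts)) !                    ∎
      where
      open ≡-Reasoning
      kt = k * size t
      kts = k * sizes ts
      ∣S∣≡kt+kts : ∣ S ∣ ≡ kt + kts
      ∣S∣≡kt+kts = trans ∣S∣≡ (*-distribˡ-+ k (size t) (sizes ts))
      extensions-count : ∀ {A} → A ∈ subsetsOfSize S kt →
                         length (extensions t ts S A) * (hookProd k t * hookProds k ts) ≡ kt ! * kts !
      extensions-count {A} A∈ with A⊆S , ∣A∣≡ ← ∈-subsetsOfSize⁻ _ S A∈ = begin
        length (extensions t ts S A) * (hookProd k t * hookProds k ts)
          ≡⟨ cong (_* _) (length-cartesianProductWith _∷_ (labellings t A) F) ⟩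
        (length (labellings t A) * length F) * (hookProd k t * hookProds k ts)
          ≡⟨ interchange *-commutativeSemigroup (length (labellings t A)) (length F) (hookProd k t) (hookProds k ts) ⟩
        (length (labellings t A) * hookProd k t) * (length F * hookProds k ts)
          ≡⟨ cong₂ _*_ (labellings-count t ∣A∣≡)
                       (forestLabellings-count ts (∣S─A∣≡k*b S A (size t) (sizes ts) A⊆S ∣A∣≡ ∣S∣≡)) ⟩
        kt ! * kts !  ∎
        where F = forestLabellings ts (S ─ A)

lemma6p1 : (k : ℕ) → 1 ≤ k → (T : Tree) →
    ∃ λ (ls : List (LTree (Subset (k * size T)))) →
      Unique ls ×
      (∀ t → IsIncreasingLabelling k T t ⇔ t ∈ ls) ×
      length ls * hookProd k T ≡ (k * size T) !
lemma6p1 k 1≤k T = labellings T ⊤ , labellings-unique T ∣⊤∣≡ , characterisation , labellings-count T ∣⊤∣≡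
  where
  open Labellings k {k * size T}
  ∣⊤∣≡ : ∣ ⊤ {k * size T} ∣ ≡ k * size T
  ∣⊤∣≡ = ∣⊤∣≡n (k * size T)
  characterisation : ∀ t → IsIncreasingLabelling k T t ⇔ t ∈ labellings T ⊤
  characterisation t = mk⇔
    (λ (shape≡ , sizes≡k , pairwiseDisjoint , increasing) → labellings-complete 1≤k
       (shape≡ , increasing , partition-⊤ sizes≡k pairwiseDisjoint
                                (cong (k *_) (trans (length-labels t) (cong size shape≡)))))
    (λ t∈ → let shape≡ , increasing , P = labellings-sound T t∈ ∣⊤∣≡
            in  shape≡ , blockSizes P , disjoint P , increasing)
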